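{- Let $f$ be a low-defect polynomial of degree $r$. Then $f$ is a polynomial in the variables $x_1,\dots,x_r$, it is multilinear (of degree $1$ in each of $x_1,\dots,x_r$), its coefficients are nonnegative integers, its constant term is nonzero, and the coefficient of $x_1x_2\cdots x_r$ is nonzero.
   Context: $\|n\|$ is the complexity of a positive integer $n$: the least number of $1$'s needed to write $n$ using $1$, $+$, $\times$ and parentheses. For polynomials $f_1$ in $x_1,\dots,x_{r_1}$ and $f_2$ in $x_1,\dots,x_{r_2}$, $(f_1\otimes f_2)(x_1,\dots,x_{r_1+r_2})=f_1(x_1,\dots,x_{r_1})f_2(x_{r_1+1},\dots,x_{r_1+r_2})$. The set of low-defect pairs is the smallest subset $\mathscr{P}\subseteq\mathbb{Z}[x_1,x_2,\dots]\times\mathbb{N}$ such that: (i) for each positive integer constant $k$ and integer $C\ge\|k\|$, $(k,C)\in\mathscr{P}$; (ii) if $(f_1,C_1),(f_2,C_2)\in\mathscr{P}$ then $(f_1\otimes f_2,C_1+C_2)\in\mathscr{P}$; (iii) if $(f,C)\in\mathscr{P}$ with $f$ in $x_1,\dots,x_r$, $c$ a positive integer and $D\ge\|c\|$, then $(f(x_1,\dots,x_r)x_{r+1}+c,C+D)\in\mathscr{P}$. The polynomials $f$ occurring in pairs of $\mathscr{P}$ are the low-defect polynomials; the degree of a low-defect polynomial is the number of variables introduced in its construction (constants have degree $0$, $\otimes$ adds degrees, step (iii) adds one). -}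

module Defs where

open import Data.Nat as ℕ using (ℕ; zero; suc; _≤_)
open import Data.Integer as ℤ using (ℤ; +_)
open import Data.Bool using (Bool; true; false; _∧_; if_then_else_)
open import Data.List using (List; []; _∷_; _++_; replicate; map; concatMap)
open import Data.Product using (Σ; _×_; _,_)
open import Relation.Binary.PropositionalEquality using (_≡_)

data OneExpr : Set where
  one  : OneExpr
  _⊕_  : OneExpr → OneExpr → OneExpr
  _⊛_  : OneExpr → OneExpr → OneExpr

evalE : OneExpr → ℕ
evalE one     = 1
evalE (a ⊕ b) = evalE a ℕ.+ evalE b
evalE (a ⊛ b) = evalE a ℕ.* evalE b

ones : OneExpr → ℕ
ones one     = 1
ones (a ⊕ b) = ones a ℕ.+ ones b
ones (a ⊛ b) = ones a ℕ.+ ones b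

IsComplexity : ℕ → ℕ → Set
IsComplexity n m =
  (Σ OneExpr λ e → evalE e ≡ n × ones e ≡ m) ×
  ((e : OneExpr) → evalE e ≡ n → m ≤ ones e)

ComplexityAtMost : ℕ → ℕ → Set
ComplexityAtMost n C = Σ ℕ λ m → IsComplexity n m × m ≤ C

-- A monomial is a list of exponents: e₀ ∷ e₁ ∷ … stands for x₁^e₀ x₂^e₁ …
-- (missing trailing exponents are 0).  A polynomial is a finite list of
-- (coefficient, monomial) terms, standing for their sum.

Monomial : Set
Monomial = List ℕ

Poly : Set
Poly = List (ℤ × Monomial)

expo : Monomial → ℕ → ℕ
expo []       _       = 0
expo (e ∷ es) zero    = e
expo (e ∷ es) (suc i) = expo es i

sameMon : Monomial → Monomial → Bool
sameMon []       []       = true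
sameMon []       (y ∷ ys) = (y ℕ.≡ᵇ 0) ∧ sameMon [] ys
sameMon (x ∷ xs) []       = (x ℕ.≡ᵇ 0) ∧ sameMon xs []
sameMon (x ∷ xs) (y ∷ ys) = (x ℕ.≡ᵇ y) ∧ sameMon xs ys

coeff : Poly → Monomial → ℤ
coeff []            m = + 0
coeff ((c , e) ∷ p) m = if sameMon e m then c ℤ.+ coeff p m else coeff p m

mulMon : Monomial → Monomial → Monomial
mulMon []       ys       = ys
mulMon (x ∷ xs) []       = x ∷ xs
mulMon (x ∷ xs) (y ∷ ys) = (x ℕ.+ y) ∷ mulMon xs ys

const : ℤ → Poly
const c = (c , []) ∷ []

var : ℕ → Poly
var i = (+ 1 , replicate i 0 ++ (1 ∷ [])) ∷ []

_+P_ : Poly → Poly → Poly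
p +P q = p ++ q

_*P_ : Poly → Poly → Poly
p *P q = concatMap (λ { (c , e) → map (λ { (d , e') → (c ℤ.* d , mulMon e e') }) q }) p

shift : ℕ → Poly → Poly
shift r = map (λ { (c , e) → (c , replicate r 0 ++ e) })

-- (f₁ ⊗ f₂)(x₁,…,x_{r₁+r₂}) = f₁(x₁,…,x_{r₁}) f₂(x_{r₁+1},…,x_{r₁+r₂})
tensor : ℕ → Poly → Poly → Poly
tensor r₁ f₁ f₂ = f₁ *P shift r₁ f₂

-- Low-defect pairs, indexed also by the degree (number of variables
-- introduced in the construction).
-- LowDefect f r C : (f , C) ∈ 𝒫 via a construction of degree r.

data LowDefect : Poly → ℕ → ℕ → Set where
  ld-const  : (k C : ℕ) → 1 ≤ k → ComplexityAtMost k C →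
              LowDefect (const (+ k)) 0 C
  ld-tensor : {f₁ f₂ : Poly} {r₁ r₂ C₁ C₂ : ℕ} →
              LowDefect f₁ r₁ C₁ → LowDefect f₂ r₂ C₂ →
              LowDefect (tensor r₁ f₁ f₂) (r₁ ℕ.+ r₂) (C₁ ℕ.+ C₂)
  ld-step   : {f : Poly} {r C : ℕ} → LowDefect f r C →
              (c D : ℕ) → 1 ≤ c → ComplexityAtMost c D →
              LowDefect ((f *P var r) +P const (+ c)) (suc r) (C ℕ.+ D)

IsLowDefectPoly : Poly → ℕ → Set
IsLowDefectPoly f r = Σ ℕ λ C → LowDefect f r C

module Submission where

-- We prove,
-- by induction on the construction of a low-defect pair, that the term list of
-- a low-defect polynomial f of degree r has the following `Shape`:
--   * every term has a positive coefficient;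
--   * every monomial divides x₁x₂⋯x_r (exponent ≤ 1 below r, 0 from r on);
--   * some term has the constant monomial, and some term has x₁x₂⋯x_r.
-- The monomial facts reduce to two identities on exponent functions: the
-- ⊗-product of the constant monomials is constant, and the ⊗-product of
-- x₁⋯x_{r₁} with x₁⋯x_{r₂} is x₁⋯x_{r₁+r₂}.  Step (iii) is the special case
-- f ⊗ x₁ of the tensor product, followed by appending a constant term.
-- Finally, since all coefficients are positive, `coeff f m` is a sum of
-- positive integers over the terms whose monomial equals m: it is nonnegative,
-- it is nonzero only if such a term exists, and it is nonzero when one does.

open import Defs
open import Data.Nat using (ℕ; _≤_; _≥_)
open import Data.Integer using (+_) renaming (_≤_ to _≤ℤ_)
open import Data.List using ([]; replicate)
open import Data.Product using (_×_)
open import Relation.Binary.PropositionalEquality using (_≡_; _≢_)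

open import Function using (_∘_)
open import Function.Bundles using (Equivalence)
open import Data.Nat using (zero; suc; _+_; z≤n; s≤s)
open import Data.Nat.Properties using (≤-refl; ≤-trans; +-identityʳ; +-comm; +-mono-≤; n≤0⇒n≡0; ≡ᵇ⇒≡; ≡⇒≡ᵇ)
open import Data.Integer using (ℤ; +≤+; +[1+_])
import Data.Integer as ℤ
open import Data.Bool using (true; false; T)
open import Data.Bool.Properties using (T-∧)
open import Data.List using (_∷_; _++_)
open import Data.List.Relation.Unary.All using (All; []; _∷_; lookupAny)
import Data.List.Relation.Unary.All as All
import Data.List.Relation.Unary.All.Properties as All
open import Data.List.Relation.Unary.Any using (Any; here; there)
import Data.List.Relation.Unary.Any as Any
import Data.List.Relation.Unary.Any.Properties as Any
open import Data.Product using (∃-syntax; _,_; proj₁; proj₂)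
open import Data.Empty using (⊥-elim)
open import Relation.Binary.PropositionalEquality using (refl; sym; cong; cong₂; subst; subst₂)

record Pointwise (_∼_ : ℕ → ℕ → Set) (a b : Monomial) : Set where
  constructor pointwise
  field at : ∀ i → expo a i ∼ expo b i

open Pointwise

_≈ₘ_ : Monomial → Monomial → Set
_≈ₘ_ = Pointwise _≡_

_≤ₘ_ : Monomial → Monomial → Set
_≤ₘ_ = Pointwise _≤_

prodVars : ℕ → Monomial
prodVars r = replicate r 1

shiftMon : ℕ → Monomial → Monomial
shiftMon r e = replicate r 0 ++ e

tensorMon : ℕ → Monomial → Monomial → Monomial
tensorMon r e e' = mulMon e (shiftMon r e')

expo-mulMon : ∀ a b i → expo (mulMon a b) i ≡ expo a i + expo b i
expo-mulMon []       b        i       = refl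
expo-mulMon (x ∷ xs) []       i       = sym (+-identityʳ _)
expo-mulMon (x ∷ xs) (y ∷ ys) zero    = refl
expo-mulMon (x ∷ xs) (y ∷ ys) (suc i) = expo-mulMon xs ys i

shift-pointwise : ∀ {_∼_ : ℕ → ℕ → Set} r {a b} → 0 ∼ 0 →
  Pointwise _∼_ a b → Pointwise _∼_ (shiftMon r a) (shiftMon r b)
shift-pointwise zero    z a∼b .at i       = a∼b .at i
shift-pointwise (suc r) z a∼b .at zero    = z
shift-pointwise (suc r) z a∼b .at (suc i) = shift-pointwise r z a∼b .at i

pointwise-respʳ : ∀ {_∼_ : ℕ → ℕ → Set} {a b c} → Pointwise _∼_ a b → b ≈ₘ c → Pointwise _∼_ a c
pointwise-respʳ {_∼_} a∼b b≈c .at i = subst (_∼_ _) (b≈c .at i) (a∼b .at i)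

mulMon-pointwise : ∀ {_∼_ : ℕ → ℕ → Set} {a b c d} →
  (∀ {w x y z} → w ∼ x → y ∼ z → (w + y) ∼ (x + z)) →
  Pointwise _∼_ a b → Pointwise _∼_ c d → Pointwise _∼_ (mulMon a c) (mulMon b d)
mulMon-pointwise {_∼_} {a} {b} {c} {d} +-compat a∼b c∼d = pointwise λ i →
  subst₂ _∼_ (sym (expo-mulMon a c i)) (sym (expo-mulMon b d i))
    (+-compat (a∼b .at i) (c∼d .at i))

tensorMon-pointwise : ∀ {_∼_ : ℕ → ℕ → Set} r {a b c d} → 0 ∼ 0 →
  (∀ {w x y z} → w ∼ x → y ∼ z → (w + y) ∼ (x + z)) →
  Pointwise _∼_ a b → Pointwise _∼_ c d →
  Pointwise _∼_ (tensorMon r a c) (tensorMon r b d)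
tensorMon-pointwise r z +-compat a∼b c∼d =
  mulMon-pointwise +-compat a∼b (shift-pointwise r z c∼d)

tensorMon-constant : ∀ r → tensorMon r [] [] ≈ₘ []
tensorMon-constant zero    .at i       = refl
tensorMon-constant (suc r) .at zero    = refl
tensorMon-constant (suc r) .at (suc i) = tensorMon-constant r .at i

tensorMon-prodVars : ∀ r₁ r₂ → tensorMon r₁ (prodVars r₁) (prodVars r₂) ≈ₘ prodVars (r₁ + r₂)
tensorMon-prodVars zero     r₂ .at i       = refl
tensorMon-prodVars (suc r₁) r₂ .at zero    = refl
tensorMon-prodVars (suc r₁) r₂ .at (suc i) = tensorMon-prodVars r₁ r₂ .at i

prodVars-≤1 : ∀ r i → expo (prodVars r) i ≤ 1
prodVars-≤1 zero    i       = z≤n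
prodVars-≤1 (suc r) zero    = ≤-refl
prodVars-≤1 (suc r) (suc i) = prodVars-≤1 r i

prodVars-beyond : ∀ r i → i ≥ r → expo (prodVars r) i ≡ 0
prodVars-beyond zero    i       _ = refl
prodVars-beyond (suc r) (suc i) (s≤s r≤i) = prodVars-beyond r i r≤i

sameMon-sound : ∀ a b → T (sameMon a b) → a ≈ₘ b
sameMon-sound []       []       _ .at i       = refl
sameMon-sound []       (y ∷ ys) h .at zero    = sym (≡ᵇ⇒≡ y 0 (proj₁ (Equivalence.to T-∧ h)))
sameMon-sound []       (y ∷ ys) h .at (suc i) = sameMon-sound [] ys (proj₂ (Equivalence.to T-∧ h)) .at i
sameMon-sound (x ∷ xs) []       h .at zero    = ≡ᵇ⇒≡ x 0 (proj₁ (Equivalence.to T-∧ h))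
sameMon-sound (x ∷ xs) []       h .at (suc i) = sameMon-sound xs [] (proj₂ (Equivalence.to T-∧ h)) .at i
sameMon-sound (x ∷ xs) (y ∷ ys) h .at zero    = ≡ᵇ⇒≡ x y (proj₁ (Equivalence.to T-∧ h))
sameMon-sound (x ∷ xs) (y ∷ ys) h .at (suc i) = sameMon-sound xs ys (proj₂ (Equivalence.to T-∧ h)) .at i

sameMon-complete : ∀ a b → a ≈ₘ b → T (sameMon a b)
sameMon-complete []       []       _   = _
sameMon-complete []       (y ∷ ys) a≈b = Equivalence.from T-∧
  (≡⇒≡ᵇ y 0 (sym (a≈b .at 0)) , sameMon-complete [] ys (pointwise (a≈b .at ∘ suc)))
sameMon-complete (x ∷ xs) []       a≈b = Equivalence.from T-∧
  (≡⇒≡ᵇ x 0 (a≈b .at 0) , sameMon-complete xs [] (pointwise (a≈b .at ∘ suc)))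
sameMon-complete (x ∷ xs) (y ∷ ys) a≈b = Equivalence.from T-∧
  (≡⇒≡ᵇ x y (a≈b .at 0) , sameMon-complete xs ys (pointwise (a≈b .at ∘ suc)))

Term : Set
Term = ℤ × Monomial

OnMonomial : (Monomial → Set) → Term → Set
OnMonomial P = P ∘ proj₂

HasPositiveCoeff : Term → Set
HasPositiveCoeff (c , _) = ∃[ n ] c ≡ +[1+ n ]

tensorTerm : ℕ → Term → Term → Term
tensorTerm r (c , e) (d , e') = (c ℤ.* d , tensorMon r e e')

All-tensor : ∀ {P Q R : Term → Set} r {f₁ f₂} →
  (∀ {u v} → P u → Q v → R (tensorTerm r u v)) →
  All P f₁ → All Q f₂ → All R (tensor r f₁ f₂)
All-tensor r h ps qs =
  All.concat⁺ (All.map⁺ (All.map (λ pu → All.map⁺ (All.map⁺ (All.map (h pu) qs))) ps))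

Any-tensor : ∀ {P Q R : Term → Set} r {f₁ f₂} →
  (∀ {u v} → P u → Q v → R (tensorTerm r u v)) →
  Any P f₁ → Any Q f₂ → Any R (tensor r f₁ f₂)
Any-tensor r h ps qs =
  Any.concat⁺ (Any.map⁺ (Any.map (λ pu → Any.map⁺ (Any.map⁺ (Any.map (h pu) qs))) ps))

positive-tensor : ∀ r {f₁ f₂} → All HasPositiveCoeff f₁ → All HasPositiveCoeff f₂ →
  All HasPositiveCoeff (tensor r f₁ f₂)
positive-tensor r = All-tensor r λ { (_ , refl) (_ , refl) → _ , refl }

bounded-tensor : ∀ r₁ r₂ {f₁ f₂} →
  All (OnMonomial (_≤ₘ prodVars r₁)) f₁ → All (OnMonomial (_≤ₘ prodVars r₂)) f₂ →
  All (OnMonomial (_≤ₘ prodVars (r₁ + r₂))) (tensor r₁ f₁ f₂)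
bounded-tensor r₁ r₂ = All-tensor r₁ λ e≤ e'≤ →
  pointwise-respʳ (tensorMon-pointwise r₁ z≤n +-mono-≤ e≤ e'≤) (tensorMon-prodVars r₁ r₂)

constant-tensor : ∀ r {f₁ f₂} →
  Any (OnMonomial (_≈ₘ [])) f₁ → Any (OnMonomial (_≈ₘ [])) f₂ →
  Any (OnMonomial (_≈ₘ [])) (tensor r f₁ f₂)
constant-tensor r = Any-tensor r λ e≈ e'≈ →
  pointwise-respʳ (tensorMon-pointwise r refl (cong₂ _+_) e≈ e'≈) (tensorMon-constant r)

leading-tensor : ∀ r₁ r₂ {f₁ f₂} →
  Any (OnMonomial (_≈ₘ prodVars r₁)) f₁ → Any (OnMonomial (_≈ₘ prodVars r₂)) f₂ →
  Any (OnMonomial (_≈ₘ prodVars (r₁ + r₂))) (tensor r₁ f₁ f₂)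
leading-tensor r₁ r₂ = Any-tensor r₁ λ e≈ e'≈ →
  pointwise-respʳ (tensorMon-pointwise r₁ refl (cong₂ _+_) e≈ e'≈) (tensorMon-prodVars r₁ r₂)

record Shape (f : Poly) (r : ℕ) : Set where
  field
    positive : All HasPositiveCoeff f
    bounded  : All (OnMonomial (_≤ₘ prodVars r)) f
    constant : Any (OnMonomial (_≈ₘ [])) f
    leading  : Any (OnMonomial (_≈ₘ prodVars r)) f

open Shape

shape-const : ∀ k → Shape (const +[1+ k ]) 0
shape-const k = record
  { positive = (k , refl) ∷ []
  ; bounded  = (pointwise λ i → z≤n) ∷ []
  ; constant = here (pointwise λ i → refl)
  ; leading  = here (pointwise λ i → refl)
  }

shape-tensor : ∀ {f₁ f₂ r₁ r₂} → Shape f₁ r₁ → Shape f₂ r₂ → Shape (tensor r₁ f₁ f₂) (r₁ + r₂)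
shape-tensor {r₁ = r₁} {r₂} s₁ s₂ = record
  { positive = positive-tensor r₁ (positive s₁) (positive s₂)
  ; bounded  = bounded-tensor r₁ r₂ (bounded s₁) (bounded s₂)
  ; constant = constant-tensor r₁ (constant s₁) (constant s₂)
  ; leading  = leading-tensor r₁ r₂ (leading s₁) (leading s₂)
  }

-- Rule (iii): f *P var r is, by definition, f ⊗ x₁ (with x₁ = var 0), of
-- degree r + 1 = suc r; the appended positive constant supplies the constant term.
shape-step : ∀ {f r} c → Shape f r → Shape ((f *P var r) +P const +[1+ c ]) (suc r)
shape-step {f} {r} c s = record
  { positive = All.++⁺ (positive-tensor r (positive s) ((0 , refl) ∷ [])) ((c , refl) ∷ [])
  ; bounded  = All.++⁺ product-bounded ((pointwise λ i → z≤n) ∷ [])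
  ; constant = Any.++⁺ʳ (f *P var r) (here (pointwise λ i → refl))
  ; leading  = Any.++⁺ˡ product-leading
  }
  where
  product-bounded : All (OnMonomial (_≤ₘ prodVars (suc r))) (f *P var r)
  product-bounded = subst (λ d → All (OnMonomial (_≤ₘ prodVars d)) (f *P var r)) (+-comm r 1)
    (bounded-tensor r 1 {f} {var 0} (bounded s) ((pointwise λ i → ≤-refl) ∷ []))
  product-leading : Any (OnMonomial (_≈ₘ prodVars (suc r))) (f *P var r)
  product-leading = subst (λ d → Any (OnMonomial (_≈ₘ prodVars d)) (f *P var r)) (+-comm r 1)
    (leading-tensor r 1 {f} {var 0} (leading s) (here (pointwise λ i → refl)))

lowDefect-shape : ∀ {f r C} → LowDefect f r C → Shape f r
lowDefect-shape (ld-const (suc k) _ _ _) = shape-const k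
lowDefect-shape (ld-tensor d₁ d₂)         = shape-tensor (lowDefect-shape d₁) (lowDefect-shape d₂)
lowDefect-shape (ld-step d (suc c) _ _ _) = shape-step c (lowDefect-shape d)

-- coeff f m is a sum of positive integers, hence a natural number.
coeff-natural : ∀ {f} → All HasPositiveCoeff f → ∀ m → ∃[ k ] coeff f m ≡ + k
coeff-natural []                          m = 0 , refl
coeff-natural {(_ , e) ∷ f} ((n , refl) ∷ ps) m with sameMon e m | coeff-natural ps m
... | true  | k , eq = suc n + k , cong (ℤ._+_ +[1+ n ]) eq
... | false | k , eq = k , eq

coeff-positive : ∀ {f m} → All HasPositiveCoeff f → Any (OnMonomial (_≈ₘ m)) f →
  ∃[ k ] coeff f m ≡ +[1+ k ]
coeff-positive {(_ , e) ∷ f} {m} ((n , refl) ∷ ps) (here e≈m)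
  with sameMon e m | sameMon-complete e m e≈m | coeff-natural ps m
... | true | _ | k , eq = n + k , cong (ℤ._+_ +[1+ n ]) eq
coeff-positive {(_ , e) ∷ f} {m} ((n , refl) ∷ ps) (there p)
  with sameMon e m | coeff-positive ps p
... | true  | k , eq = n + suc k , cong (ℤ._+_ +[1+ n ]) eq
... | false | k , eq = k , eq

coeff-nonzero : ∀ {f m} → All HasPositiveCoeff f → Any (OnMonomial (_≈ₘ m)) f → coeff f m ≢ + 0
coeff-nonzero ps p coeff≡0 with coeff-positive ps p
... | k , eq with () ← subst (_≡ + 0) eq coeff≡0

coeff-support : ∀ f m → coeff f m ≢ + 0 → Any (OnMonomial (_≈ₘ m)) f
coeff-support []            m ≢0 = ⊥-elim (≢0 refl)
coeff-support ((_ , e) ∷ f) m ≢0 with sameMon e m | sameMon-sound e m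
... | true  | sound = here (sound _)
... | false | _     = there (coeff-support f m ≢0)

support-bounded : ∀ {f b} → All (OnMonomial (_≤ₘ b)) f → ∀ m → coeff f m ≢ + 0 → m ≤ₘ b
support-bounded {f} bs m ≢0 .at i with lookupAny bs (coeff-support f m ≢0)
... | e≤b , e≈m = subst (_≤ _) (e≈m .at i) (e≤b .at i)

proposition4p2 : (f : Poly) (r : ℕ) → IsLowDefectPoly f r →
    ((m : Monomial) → coeff f m ≢ + 0 → (i : ℕ) → i ≥ r → expo m i ≡ 0) ×
    ((m : Monomial) → coeff f m ≢ + 0 → (i : ℕ) → expo m i ≤ 1) ×
    ((m : Monomial) → + 0 ≤ℤ coeff f m) ×
    (coeff f [] ≢ + 0) ×
    (coeff f (replicate r 1) ≢ + 0)
proposition4p2 f r (_ , d) =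
  (λ m ≢0 i i≥r → n≤0⇒n≡0 (subst (_ ≤_) (prodVars-beyond r i i≥r) (divides m ≢0 .at i))) ,
  (λ m ≢0 i → ≤-trans (divides m ≢0 .at i) (prodVars-≤1 r i)) ,
  (λ m → subst (+ 0 ≤ℤ_) (sym (proj₂ (coeff-natural (positive s) m))) (+≤+ z≤n)) ,
  coeff-nonzero (positive s) (constant s) ,
  coeff-nonzero (positive s) (leading s)
  where
  s : Shape f r
  s = lowDefect-shape d
  divides : ∀ m → coeff f m ≢ + 0 → m ≤ₘ prodVars r
  divides = support-bounded (bounded s)
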